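{- Let $n,r$ be integers with $n\ge r-1\ge 3$, and let $k_2=\left\lceil\frac{(\binom{r}{2}-1)\binom{n}{2}}{t_{r-1}(n)}\right\rceil$. Then: (i) if $n\ge r+1$, then $k_2\ge\binom{r}{2}+1$; (ii) for every integer $s$ with $1\le s\le\min\{r-1,n-1\}$, $t_{r-1}(n)-t_{r-1}(n-s)\ge\binom{s}{2}+\frac{r-2}{r-1}s(n-s)$; (iii) for every integer $s$ with $1\le s\le n-1$, $\frac{t_{r-1}(n-s)}{t_{r-1}(n)}\ge\frac{\binom{n-s}{2}}{\binom{n}{2}}$; (iv) if $n\ge r+1$, then for every integer $s$ with $1\le s\le r-1$, $$\left(\binom{r}{2}-1\right)\left(\binom{n}{2}-\binom{n-s}{2}\right)\ge\binom{r}{2}\left(\binom{s}{2}+\frac{r-2}{r-1}s(n-s)\right)+n-s.$$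
   Context: $t_{r-1}(n)$ denotes the number of edges of the Turán graph $T_{r-1}(n)$, the complete $(r-1)$-partite graph on $n$ vertices whose part sizes differ by at most one (with $t_{r-1}(0)=t_{r-1}(1)=0$). -}

module Defs where

open import Data.Nat using (ℕ; zero; suc; _+_; _*_; _∸_; _/_)
open import Data.List using (List; []; _∷_; map; upTo)
open import Data.Nat.ListAction using (sum)

-- Number of edges of the complete multipartite graph with the given part sizes:
-- sum over unordered pairs of parts of the product of their sizes.
multipartiteEdges : List ℕ → ℕ
multipartiteEdges []       = 0
multipartiteEdges (a ∷ as) = a * sum as + multipartiteEdges as

-- Part sizes of the Turán graph T_p(n): p parts, the i-th (0 ≤ i < p) of size
-- ⌊(n + i) / p⌋; these sum to n and differ by at most one.
turanParts : ℕ → ℕ → List ℕ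
turanParts zero    n = []
turanParts (suc q) n = map (λ i → (n + i) / suc q) (upTo (suc q))

turan : ℕ → ℕ → ℕ
turan p n = multipartiteEdges (turanParts p n)

-- ⌈ a / b ⌉ (conventionally 0 when b = 0; never used with b = 0 here).
ceilDiv : ℕ → ℕ → ℕ
ceilDiv a zero    = 0
ceilDiv a (suc b) = (a + b) / suc b

{-# OPTIONS --safe #-}
-- Write p = r - 1 and T(n) = t_p(n).  The parts of T_p(n) have sizes ⌊(n + i)/p⌋
-- for i < p, and adding a vertex to a smallest part gives
-- T(n + 1) = T(n) + n - ⌊n/p⌋.  Summing this over s ≤ p steps reduces (ii) to
-- p ∑_{i<s} ⌊(m + i)/p⌋ ≤ s m, which holds because these floors are
-- nondecreasing and, by Hermite's identity, the first p of them sum to m.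
-- Every vertex of T_p(n + 1) has degree at least T(n + 1) - T(n), so double
-- counting the edges left after deleting one vertex gives
-- (n - 1) T(n + 1) ≤ (n + 1) T(n): the density T(n) / C(n,2) is nonincreasing,
-- which is (iii).  For (i) it then suffices to check n = p + 2, where
-- T(p + 2) = C(p + 2, 2) - 2; (iv) is an inequality about binomial coefficients.
module Submission where

open import Defs
open import Data.Nat using (ℕ; zero; suc; _+_; _*_; _∸_; _≤_; _<_; _/_; pred; s≤s; z≤n;
  _≤′_; ≤′-refl; ≤′-step; >-nonZero)
open import Data.Nat.Properties
open import Data.Nat.DivMod using (+-distrib-/-∣ʳ; n/n≡1; /-monoˡ-≤; m<n⇒m/n≡0; m/n≤m; m*n/n≡m)
open import Data.Nat.Divisibility using (∣-refl)
open import Data.Nat.Combinatorics using (_C_; nCk+nC[k+1]≡[n+1]C[k+1]; nC1≡n)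
open import Data.Nat.ListAction using (sum)
open import Data.Nat.ListAction.Properties using (sum-++)
open import Data.Nat.Tactic.RingSolver using (solve-∀)
open import Data.List using (List; []; _∷_; _∷ʳ_; [_]; applyUpTo)
open import Data.List.Properties using (map-upTo; applyUpTo-∷ʳ)
open import Data.List.Relation.Unary.All using (All; []; _∷_)
open import Data.List.Relation.Unary.All.Properties using (applyUpTo⁺₁)
open import Data.Product using (_×_; _,_)
open import Relation.Binary.Core using (_Preserves_⟶_)
open import Relation.Binary.PropositionalEquality
  using (_≡_; refl; sym; trans; cong; cong₂; subst; module ≡-Reasoning)
open import Algebra.Properties.CommutativeSemigroup *-commutativeSemigroup
  using () renaming (x∙yz≈y∙xz to x*[y*z]≡y*[x*z]; x∙yz≈z∙yx to x*[y*z]≡z*[y*x];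
                     xy∙z≈y∙xz to x*y*z≡y*[x*z])
open import Algebra.Properties.CommutativeSemigroup +-commutativeSemigroup
  using () renaming (x∙yz≈xz∙y to x+[y+z]≡x+z+y; xy∙z≈xz∙y to x+y+z≡x+z+y)

∑< : ℕ → (ℕ → ℕ) → ℕ
∑< zero    f = 0
∑< (suc n) f = f 0 + ∑< n (λ i → f (suc i))

-- Indexed by ℕ rather than Fin n, so that summands such as ⌊(m + i)/p⌋ need no toℕ.
syntax ∑< n (λ i → e) = ∑[ i < n ] e

∑-cong : ∀ {f g : ℕ → ℕ} n → (∀ i → f i ≡ g i) → ∑[ i < n ] f i ≡ ∑[ i < n ] g i
∑-cong zero    f≗g = refl
∑-cong (suc n) f≗g = cong₂ _+_ (f≗g 0) (∑-cong n (λ i → f≗g (suc i)))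

∑-+ : ∀ (f : ℕ → ℕ) m n → ∑[ i < m + n ] f i ≡ ∑[ i < m ] f i + ∑[ i < n ] f (m + i)
∑-+ f zero    n = refl
∑-+ f (suc m) n = trans (cong (f 0 +_) (∑-+ (λ i → f (suc i)) m n)) (sym (+-assoc (f 0) _ _))

sum-applyUpTo : ∀ (f : ℕ → ℕ) n → sum (applyUpTo f n) ≡ ∑[ i < n ] f i
sum-applyUpTo f zero    = refl
sum-applyUpTo f (suc n) = cong (f 0 +_) (sum-applyUpTo (λ i → f (suc i)) n)

∑-≤-* : ∀ {f : ℕ → ℕ} {c} n → (∀ {i} → i < n → f i ≤ c) → ∑[ i < n ] f i ≤ n * c
∑-≤-* zero    f≤c = z≤n
∑-≤-* (suc n) f≤c = +-mono-≤ (f≤c (s≤s z≤n)) (∑-≤-* n (λ i<n → f≤c (s≤s i<n)))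

*-≤-∑ : ∀ {f : ℕ → ℕ} {c} n → (∀ i → c ≤ f i) → n * c ≤ ∑[ i < n ] f i
*-≤-∑ zero    c≤f = z≤n
*-≤-∑ (suc n) c≤f = +-mono-≤ (c≤f 0) (*-≤-∑ n (λ i → c≤f (suc i)))

prefix-average : ∀ {f : ℕ → ℕ} → f Preserves _≤_ ⟶ _≤_ → ∀ {s n} → s ≤ n →
                 n * ∑[ i < s ] f i ≤ s * ∑[ i < n ] f i
prefix-average {f} mono {s} s≤n with m≤n⇒∃[o]m+o≡n s≤n
... | t , refl = begin
  (s + t) * A          ≡⟨ *-distribʳ-+ A s t ⟩
  s * A + t * A        ≤⟨ +-monoʳ-≤ (s * A) (*-monoʳ-≤ t A≤s*fs) ⟩
  s * A + t * (s * f s) ≡⟨ cong (s * A +_) (x*[y*z]≡y*[x*z] t s (f s)) ⟩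
  s * A + s * (t * f s) ≤⟨ +-monoʳ-≤ (s * A) (*-monoʳ-≤ s t*fs≤B) ⟩
  s * A + s * B        ≡⟨ *-distribˡ-+ s A B ⟨
  s * (A + B)          ≡⟨ cong (s *_) (sym (∑-+ f s t)) ⟩
  s * ∑[ i < s + t ] f i ∎
  where
  open ≤-Reasoning
  A = ∑[ i < s ] f i
  B = ∑[ i < t ] f (s + i)
  A≤s*fs : A ≤ s * f s
  A≤s*fs = ∑-≤-* s (λ i<s → mono (<⇒≤ i<s))
  t*fs≤B : t * f s ≤ B
  t*fs≤B = *-≤-∑ t (λ i → mono (m≤m+n s i))

ratio-antitone : ∀ (f g : ℕ → ℕ) {m} →
                 (∀ {j} → m ≤ j → 0 < g j) →
                 (∀ {j} → m ≤ j → g j * f (suc j) ≤ f j * g (suc j)) →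
                 ∀ {n} → m ≤ n → g m * f n ≤ f m * g n
ratio-antitone f g {m} g>0 step m≤n = go (≤⇒≤′ m≤n)
  where
  open ≤-Reasoning
  go : ∀ {n} → m ≤′ n → g m * f n ≤ f m * g n
  go ≤′-refl               = ≤-reflexive (*-comm (g m) (f m))
  go (≤′-step {n} m≤′n) = *-cancelˡ-≤ (g n) {{>-nonZero (g>0 (≤′⇒≤ m≤′n))}} (begin
    g n * (g m * f (suc n))   ≡⟨ x*[y*z]≡y*[x*z] (g n) (g m) (f (suc n)) ⟩
    g m * (g n * f (suc n))   ≤⟨ *-monoʳ-≤ (g m) (step (≤′⇒≤ m≤′n)) ⟩
    g m * (f n * g (suc n))   ≡⟨ *-assoc (g m) (f n) (g (suc n)) ⟨
    g m * f n * g (suc n)     ≤⟨ *-monoˡ-≤ (g (suc n)) (go m≤′n) ⟩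
    f m * g n * g (suc n)     ≡⟨ cong (_* g (suc n)) (*-comm (f m) (g n)) ⟩
    g n * f m * g (suc n)     ≡⟨ *-assoc (g n) (f m) (g (suc n)) ⟩
    g n * (f m * g (suc n))   ∎)

applyUpTo-cong : ∀ {f g : ℕ → ℕ} → (∀ i → f i ≡ g i) → ∀ n → applyUpTo f n ≡ applyUpTo g n
applyUpTo-cong f≗g zero    = refl
applyUpTo-cong f≗g (suc n) = cong₂ _∷_ (f≗g 0) (applyUpTo-cong (λ i → f≗g (suc i)) n)

[1+n]C2≡nC2+n : ∀ n → suc n C 2 ≡ n C 2 + n
[1+n]C2≡nC2+n n = begin
  suc n C 2         ≡⟨ nCk+nC[k+1]≡[n+1]C[k+1] n 1 ⟨
  n C 1 + n C 2     ≡⟨ cong (_+ n C 2) (nC1≡n n) ⟩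
  n + n C 2         ≡⟨ +-comm n (n C 2) ⟩
  n C 2 + n         ∎
  where open ≡-Reasoning

2*nC2≡n*pred[n] : ∀ n → 2 * (n C 2) ≡ n * pred n
2*nC2≡n*pred[n] zero          = refl
2*nC2≡n*pred[n] (suc zero)    = refl
2*nC2≡n*pred[n] (suc (suc n)) = begin
  2 * (suc (suc n) C 2)       ≡⟨ cong (2 *_) ([1+n]C2≡nC2+n (suc n)) ⟩
  2 * (suc n C 2 + suc n)     ≡⟨ *-distribˡ-+ 2 (suc n C 2) (suc n) ⟩
  2 * (suc n C 2) + 2 * suc n ≡⟨ cong (_+ 2 * suc n) (2*nC2≡n*pred[n] (suc n)) ⟩
  suc n * n + 2 * suc n       ≡⟨ factor n ⟩
  suc (suc n) * suc n         ∎
  where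
  open ≡-Reasoning
  factor : ∀ n → suc n * n + 2 * suc n ≡ suc (suc n) * suc n
  factor = solve-∀

[m+n]C2≡mC2+n*m+nC2 : ∀ m n → (m + n) C 2 ≡ m C 2 + (n * m + n C 2)
[m+n]C2≡mC2+n*m+nC2 m zero    = trans (cong (_C 2) (+-identityʳ m)) (sym (+-identityʳ (m C 2)))
[m+n]C2≡mC2+n*m+nC2 m (suc n) = begin
  (m + suc n) C 2                  ≡⟨ cong (_C 2) (+-suc m n) ⟩
  suc (m + n) C 2                  ≡⟨ [1+n]C2≡nC2+n (m + n) ⟩
  (m + n) C 2 + (m + n)            ≡⟨ cong (_+ (m + n)) ([m+n]C2≡mC2+n*m+nC2 m n) ⟩
  m C 2 + (n * m + n C 2) + (m + n) ≡⟨ regroup (m C 2) (n C 2) m n ⟩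
  m C 2 + (suc n * m + (n C 2 + n)) ≡⟨ cong (λ x → m C 2 + (suc n * m + x)) (sym ([1+n]C2≡nC2+n n)) ⟩
  m C 2 + (suc n * m + suc n C 2)  ∎
  where
  open ≡-Reasoning
  regroup : ∀ a b m n → a + (n * m + b) + (m + n) ≡ a + (suc n * m + (b + n))
  regroup = solve-∀

2≤n⇒nC2>0 : ∀ {n} → 2 ≤ n → 0 < n C 2
2≤n⇒nC2>0 {suc (suc n)} (s≤s (s≤s _)) = ≤-trans (s≤s z≤n)
  (≤-trans (m≤n+m (suc n) (suc n C 2)) (≤-reflexive (sym ([1+n]C2≡nC2+n (suc n)))))

[1+r]*t<[t+2]*r : ∀ {r t p} → p < r → t + 2 ≡ suc r + suc p → suc r * t < (t + 2) * r
[1+r]*t<[t+2]*r {r} {t} {p} p<r t+2≡ with m≤n⇒∃[o]m+o≡n p<r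
... | x , refl = begin-strict
  suc r * t          <⟨ m<m+n (suc r * t) (s≤s (z≤n {x})) ⟩
  suc r * t + suc x  ≡⟨ cong (λ t → suc r * t + suc x) t≡r+p ⟩
  suc r * (r + p) + suc x ≡⟨ expand p x ⟩
  (r + p + 2) * r    ≡⟨ cong (λ t → (t + 2) * r) t≡r+p ⟨
  (t + 2) * r        ∎
  where
  open ≤-Reasoning
  t≡r+p : t ≡ r + p
  t≡r+p = +-cancelʳ-≡ 2 _ _ (trans t+2≡ (regroup r p))
    where
    regroup : ∀ r p → suc r + suc p ≡ r + p + 2
    regroup = solve-∀
  expand : ∀ p x → suc (suc p + x) * (suc p + x + p) + suc x ≡ (suc p + x + p + 2) * (suc p + x)
  expand = solve-∀

multipartiteEdges-∷ʳ : ∀ xs y → multipartiteEdges (xs ∷ʳ y) ≡ multipartiteEdges xs + y * sum xs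
multipartiteEdges-∷ʳ []       y = +-identityʳ (y * 0)
multipartiteEdges-∷ʳ (x ∷ xs) y rewrite sum-++ xs [ y ] | multipartiteEdges-∷ʳ xs y =
  regroup x (sum xs) (multipartiteEdges xs) y
  where
  regroup : ∀ x s e y → x * (s + (y + 0)) + (e + y * s) ≡ (x * s + e) + y * (x + s)
  regroup = solve-∀

multipartiteEdges-rotate : ∀ x xs → multipartiteEdges (xs ∷ʳ suc x) ≡ multipartiteEdges (x ∷ xs) + sum xs
multipartiteEdges-rotate x xs =
  trans (multipartiteEdges-∷ʳ xs (suc x)) (regroup (multipartiteEdges xs) x (sum xs))
  where
  regroup : ∀ e x s → e + suc x * s ≡ (x * s + e) + s
  regroup = solve-∀

multipartiteEdges-sum≡0 : ∀ xs → sum xs ≡ 0 → multipartiteEdges xs ≡ 0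
multipartiteEdges-sum≡0 []       _  = refl
multipartiteEdges-sum≡0 (x ∷ xs) eq
  rewrite m+n≡0⇒m≡0 x eq | multipartiteEdges-sum≡0 xs (m+n≡0⇒n≡0 x eq) = refl

-- Double counting degrees: a vertex in a part of size x ≤ M has degree sum xs ∸ x ≥ sum xs ∸ M.
sum²≤2*edges+M*sum : ∀ {M} xs → All (_≤ M) xs →
                     sum xs * sum xs ≤ 2 * multipartiteEdges xs + M * sum xs
sum²≤2*edges+M*sum []               []           = z≤n
sum²≤2*edges+M*sum {M} (x ∷ xs) (x≤M ∷ xs≤M) = begin
  (x + s) * (x + s)                    ≡⟨ square-expand x s ⟩
  x * x + 2 * (x * s) + s * s          ≤⟨ +-monoʳ-≤ (x * x + 2 * (x * s)) (sum²≤2*edges+M*sum xs xs≤M) ⟩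
  x * x + 2 * (x * s) + (2 * e + M * s) ≤⟨ +-monoˡ-≤ _ (+-monoˡ-≤ _ (*-monoˡ-≤ x x≤M)) ⟩
  M * x + 2 * (x * s) + (2 * e + M * s) ≡⟨ regroup x s e M ⟩
  2 * (x * s + e) + M * (x + s)        ∎
  where
  open ≤-Reasoning
  s = sum xs
  e = multipartiteEdges xs
  square-expand : ∀ x s → (x + s) * (x + s) ≡ x * x + 2 * (x * s) + s * s
  square-expand = solve-∀
  regroup : ∀ x s e M → M * x + 2 * (x * s) + (2 * e + M * s) ≡ 2 * (x * s + e) + M * (x + s)
  regroup = solve-∀

module _ (k : ℕ) where

  private
    p : ℕ
    p = suc k

  others : ℕ → List ℕ
  others n = applyUpTo (λ i → (n + suc i) / p) k

  turanParts≡∷others : ∀ n → turanParts p n ≡ n / p ∷ others n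
  turanParts≡∷others n = trans (map-upTo _ p) (cong (λ x → x / p ∷ others n) (+-identityʳ n))

  [n+p]/p≡1+n/p : ∀ n → (n + p) / p ≡ suc (n / p)
  [n+p]/p≡1+n/p n = trans (+-distrib-/-∣ʳ n ∣-refl) (trans (cong (n / p +_) (n/n≡1 p)) (+-comm (n / p) 1))

  -- Adding a vertex enlarges a smallest part, which then becomes the last one.
  turanParts-suc : ∀ n → turanParts p (suc n) ≡ others n ∷ʳ suc (n / p)
  turanParts-suc n = begin
    turanParts p (suc n)                                     ≡⟨ map-upTo _ p ⟩
    applyUpTo (λ i → (suc n + i) / p) p                      ≡⟨ applyUpTo-∷ʳ _ k ⟨
    applyUpTo (λ i → (suc n + i) / p) k ∷ʳ (suc n + k) / p
      ≡⟨ cong₂ _∷ʳ_ (applyUpTo-cong (λ i → cong (_/ p) (sym (+-suc n i))) k)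
                    (trans (cong (_/ p) (sym (+-suc n k))) ([n+p]/p≡1+n/p n)) ⟩
    others n ∷ʳ suc (n / p)                                  ∎
    where open ≡-Reasoning

  ∑[i<p][n+i]/p : ∀ n → ∑[ i < p ] ((n + i) / p) ≡ sum (turanParts p n)
  ∑[i<p][n+i]/p n = sym (trans (cong sum (map-upTo _ p)) (sum-applyUpTo (λ i → (n + i) / p) p))

  sum-turanParts : ∀ n → sum (turanParts p n) ≡ n
  sum-turanParts zero    = n≤0⇒n≡0 (begin
    sum (turanParts p 0)    ≡⟨ ∑[i<p][n+i]/p 0 ⟨
    ∑[ i < p ] ((0 + i) / p) ≤⟨ ∑-≤-* p (λ i<p → ≤-reflexive (m<n⇒m/n≡0 i<p)) ⟩
    p * 0                   ≡⟨ *-zeroʳ p ⟩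
    0                       ∎)
    where open ≤-Reasoning
  sum-turanParts (suc n) = begin
    sum (turanParts p (suc n))             ≡⟨ cong sum (turanParts-suc n) ⟩
    sum (others n ∷ʳ suc (n / p))          ≡⟨ sum-++ (others n) [ suc (n / p) ] ⟩
    sum (others n) + (suc (n / p) + 0)     ≡⟨ regroup (sum (others n)) (n / p) ⟩
    suc (sum (n / p ∷ others n))           ≡⟨ cong (λ xs → suc (sum xs)) (sym (turanParts≡∷others n)) ⟩
    suc (sum (turanParts p n))             ≡⟨ cong suc (sum-turanParts n) ⟩
    suc n                                  ∎
    where
    open ≡-Reasoning
    regroup : ∀ s h → s + (suc h + 0) ≡ suc (h + s)
    regroup = solve-∀

  turan-suc : ∀ n → turan p (suc n) + n / p ≡ turan p n + n
  turan-suc n = begin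
    turan p (suc n) + h                            ≡⟨ cong (λ xs → multipartiteEdges xs + h) (turanParts-suc n) ⟩
    multipartiteEdges (others n ∷ʳ suc h) + h      ≡⟨ cong (_+ h) (multipartiteEdges-rotate h (others n)) ⟩
    multipartiteEdges (h ∷ others n) + sum (others n) + h ≡⟨ x+y+z≡x+z+y _ (sum (others n)) h ⟩
    multipartiteEdges (h ∷ others n) + h + sum (others n) ≡⟨ +-assoc _ h (sum (others n)) ⟩
    multipartiteEdges (h ∷ others n) + sum (h ∷ others n) ≡⟨ cong (λ xs → multipartiteEdges xs + sum xs) (turanParts≡∷others n) ⟨
    turan p n + sum (turanParts p n)               ≡⟨ cong (turan p n +_) (sum-turanParts n) ⟩
    turan p n + n                                  ∎
    where
    open ≡-Reasoning
    h = n / p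

  turanParts-≤ : ∀ n → All (_≤ (n + k) / p) (turanParts p n)
  turanParts-≤ n = subst (All _) (sym (map-upTo _ p))
    (applyUpTo⁺₁ _ p (λ i<p → /-monoˡ-≤ p (+-monoʳ-≤ n (≤-pred i<p))))

  turan-zero : turan p 0 ≡ 0
  turan-zero = multipartiteEdges-sum≡0 (turanParts p 0) (sum-turanParts 0)

  turan-complete : ∀ {n} → n ≤ p → turan p n ≡ n C 2
  turan-complete {zero}  _       = turan-zero
  turan-complete {suc n} 1+n≤p = begin
    turan p (suc n)          ≡⟨ +-identityʳ _ ⟨
    turan p (suc n) + 0      ≡⟨ cong (turan p (suc n) +_) (m<n⇒m/n≡0 1+n≤p) ⟨
    turan p (suc n) + n / p  ≡⟨ turan-suc n ⟩
    turan p n + n            ≡⟨ cong (_+ n) (turan-complete (≤-trans (n≤1+n n) 1+n≤p)) ⟩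
    n C 2 + n                ≡⟨ [1+n]C2≡nC2+n n ⟨
    suc n C 2                ∎
    where open ≡-Reasoning

  turan-mono : ∀ {m n} → m ≤ n → turan p m ≤ turan p n
  turan-mono m≤n = go (≤⇒≤′ m≤n)
    where
    go : ∀ {m n} → m ≤′ n → turan p m ≤ turan p n
    go ≤′-refl                 = ≤-refl
    go (≤′-step {n} m≤′n) = ≤-trans (go m≤′n) (+-cancelʳ-≤ (n / p) _ _ (begin
      turan p n + n / p        ≤⟨ +-monoʳ-≤ (turan p n) (m/n≤m n p) ⟩
      turan p n + n            ≡⟨ turan-suc n ⟨
      turan p (suc n) + n / p  ∎))
      where open ≤-Reasoning

  turan-+ : ∀ m s → turan p (m + s) + ∑[ i < s ] ((m + i) / p) ≡ turan p m + (s * m + s C 2)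
  turan-+ m zero    = trans (+-identityʳ _) (trans (cong (turan p) (+-identityʳ m)) (sym (+-identityʳ _)))
  turan-+ m (suc s) = begin
    turan p (m + suc s) + ∑[ i < suc s ] ((m + i) / p)
      ≡⟨ cong₂ _+_ (cong (turan p) (+-suc m s))
                   (cong₂ _+_ (cong (_/ p) (+-identityʳ m)) (∑-cong s (λ i → cong (_/ p) (+-suc m i)))) ⟩
    turan p (suc m + s) + (m / p + ∑[ i < s ] ((suc m + i) / p))
      ≡⟨ x+[y+z]≡x+z+y (turan p (suc m + s)) (m / p) _ ⟩
    (turan p (suc m + s) + ∑[ i < s ] ((suc m + i) / p)) + m / p
      ≡⟨ cong (_+ m / p) (turan-+ (suc m) s) ⟩
    (turan p (suc m) + (s * suc m + s C 2)) + m / p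
      ≡⟨ x+y+z≡x+z+y (turan p (suc m)) (s * suc m + s C 2) (m / p) ⟩
    (turan p (suc m) + m / p) + (s * suc m + s C 2)
      ≡⟨ cong (_+ (s * suc m + s C 2)) (turan-suc m) ⟩
    (turan p m + m) + (s * suc m + s C 2)
      ≡⟨ regroup (turan p m) m s (s C 2) ⟩
    turan p m + (suc s * m + (s C 2 + s))
      ≡⟨ cong (λ x → turan p m + (suc s * m + x)) (sym ([1+n]C2≡nC2+n s)) ⟩
    turan p m + (suc s * m + suc s C 2) ∎
    where
    open ≡-Reasoning
    regroup : ∀ t m s c → (t + m) + (s * suc m + c) ≡ t + (suc s * m + (c + s))
    regroup = solve-∀

  -- Hermite's identity: the first p of these nondecreasing floors sum to m.
  p*∑[m+i]/p≤s*m : ∀ m {s} → s ≤ p → p * ∑[ i < s ] ((m + i) / p) ≤ s * m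
  p*∑[m+i]/p≤s*m m {s} s≤p = begin
    p * ∑[ i < s ] ((m + i) / p)  ≤⟨ prefix-average (λ i≤j → /-monoˡ-≤ p (+-monoʳ-≤ m i≤j)) s≤p ⟩
    s * ∑[ i < p ] ((m + i) / p)  ≡⟨ cong (s *_) (trans (∑[i<p][n+i]/p m) (sum-turanParts m)) ⟩
    s * m                         ∎
    where open ≤-Reasoning

  turan-gap : ∀ m {s} → s ≤ p → p * turan p m + (p * (s C 2) + k * (s * m)) ≤ p * turan p (m + s)
  turan-gap m {s} s≤p = +-cancelʳ-≤ (s * m) _ _ (begin
    p * turan p m + (p * (s C 2) + k * (s * m)) + s * m  ≡⟨ factor k (turan p m) (s C 2) (s * m) ⟩
    p * (turan p m + (s * m + s C 2))                  ≡⟨ cong (p *_) (sym (turan-+ m s)) ⟩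
    p * (turan p (m + s) + W)                          ≡⟨ *-distribˡ-+ p (turan p (m + s)) W ⟩
    p * turan p (m + s) + p * W                        ≤⟨ +-monoʳ-≤ _ (p*∑[m+i]/p≤s*m m s≤p) ⟩
    p * turan p (m + s) + s * m                        ∎)
    where
    open ≤-Reasoning
    W = ∑[ i < s ] ((m + i) / p)
    factor : ∀ j t c x → suc j * t + (suc j * c + j * x) + x ≡ suc j * (t + (x + c))
    factor = solve-∀

  -- Every part of T_p(n) has at most ⌈n/p⌉ = ⌊(n + k)/p⌋ vertices.
  turan-lowerBound : ∀ n → n * n ≤ 2 * turan p n + (n + k) / p * n
  turan-lowerBound n = subst (λ s → s * s ≤ 2 * turan p n + (n + k) / p * s) (sum-turanParts n)
    (sum²≤2*edges+M*sum (turanParts p n) (turanParts-≤ n))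

  -- Every vertex of T_p(2 + i) has degree at least T_p(2 + i) - T_p(1 + i).
  turan-averaging : ∀ i → i * turan p (2 + i) ≤ (2 + i) * turan p (1 + i)
  turan-averaging i = +-cancelʳ-≤ (2 * U + h * n) _ _ (begin
    i * U + (2 * U + h * n)  ≡⟨ factor i U h ⟩
    n * (U + h)              ≡⟨ cong (n *_) (turan-suc (suc i)) ⟩
    n * (V + suc i)          ≡⟨ *-distribˡ-+ n V (suc i) ⟩
    n * V + n * suc i        ≤⟨ +-monoʳ-≤ (n * V) n*[1+i]≤2U+hn ⟩
    n * V + (2 * U + h * n)  ∎)
    where
    open ≤-Reasoning
    n = 2 + i
    U = turan p n
    V = turan p (1 + i)
    h = suc i / p
    ⌈n/p⌉≡1+h : (n + k) / p ≡ suc h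
    ⌈n/p⌉≡1+h = trans (cong (_/ p) (sym (+-suc (suc i) k))) ([n+p]/p≡1+n/p (suc i))
    factor : ∀ i U h → i * U + (2 * U + h * (2 + i)) ≡ (2 + i) * (U + h)
    factor = solve-∀
    square-split : ∀ i → (2 + i) * suc i + (2 + i) ≡ (2 + i) * (2 + i)
    square-split = solve-∀
    regroup : ∀ U h n → 2 * U + suc h * n ≡ 2 * U + h * n + n
    regroup = solve-∀
    n*[1+i]≤2U+hn : n * suc i ≤ 2 * U + h * n
    n*[1+i]≤2U+hn = +-cancelʳ-≤ n _ _ (begin
      n * suc i + n          ≡⟨ square-split i ⟩
      n * n                  ≤⟨ turan-lowerBound n ⟩
      2 * U + (n + k) / p * n ≡⟨ cong (λ x → 2 * U + x * n) ⌈n/p⌉≡1+h ⟩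
      2 * U + suc h * n      ≡⟨ regroup U h n ⟩
      2 * U + h * n + n      ∎)

  turan-density-step : ∀ j → (j C 2) * turan p (suc j) ≤ turan p j * (suc j C 2)
  turan-density-step zero    = z≤n
  turan-density-step (suc i) = *-cancelˡ-≤ 2 (begin
    2 * ((suc i C 2) * U)            ≡⟨ *-assoc 2 (suc i C 2) U ⟨
    2 * (suc i C 2) * U              ≡⟨ cong (_* U) (2*nC2≡n*pred[n] (suc i)) ⟩
    suc i * i * U                    ≡⟨ *-assoc (suc i) i U ⟩
    suc i * (i * U)                  ≤⟨ *-monoʳ-≤ (suc i) (turan-averaging i) ⟩
    suc i * ((2 + i) * V)            ≡⟨ x*[y*z]≡z*[y*x] (suc i) (2 + i) V ⟩
    V * ((2 + i) * suc i)            ≡⟨ cong (V *_) (sym (2*nC2≡n*pred[n] (2 + i))) ⟩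
    V * (2 * ((2 + i) C 2))          ≡⟨ x*[y*z]≡y*[x*z] V 2 ((2 + i) C 2) ⟩
    2 * (V * ((2 + i) C 2))          ∎)
    where
    open ≤-Reasoning
    U = turan p (2 + i)
    V = turan p (1 + i)

  turan-density-antitone : ∀ {m n} → m ≤ n → (m C 2) * turan p n ≤ turan p m * (n C 2)
  turan-density-antitone {zero}        _   = z≤n
  turan-density-antitone {suc zero}    _   = z≤n
  turan-density-antitone {suc (suc m)} m≤n = ratio-antitone (turan p) (_C 2)
    (λ 2+m≤j → 2≤n⇒nC2>0 (≤-trans (s≤s (s≤s z≤n)) 2+m≤j)) (λ {j} _ → turan-density-step j) m≤n

  turan-positive : 1 ≤ k → ∀ {n} → 2 ≤ n → 0 < turan p n
  turan-positive 1≤k 2≤n = ≤-trans (≤-reflexive (sym (turan-complete (s≤s 1≤k)))) (turan-mono 2≤n)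

  -- T_p(p + 2) is K_{p+2} minus the two edges inside its two parts of size 2.
  turan[2+p]+2≡[2+p]C2 : 1 ≤ k → turan p (2 + p) + 2 ≡ (2 + p) C 2
  turan[2+p]+2≡[2+p]C2 1≤k = begin
    turan p (2 + p) + 2              ≡⟨ +-assoc (turan p (2 + p)) 1 1 ⟨
    turan p (2 + p) + 1 + 1          ≡⟨ cong (_+ 1) T[2+p]+1 ⟩
    turan p (suc p) + suc p + 1      ≡⟨ x+y+z≡x+z+y (turan p (suc p)) (suc p) 1 ⟩
    turan p (suc p) + 1 + suc p      ≡⟨ cong (_+ suc p) T[1+p]+1 ⟩
    p C 2 + p + suc p                ≡⟨ cong (_+ suc p) ([1+n]C2≡nC2+n p) ⟨
    suc p C 2 + suc p                ≡⟨ [1+n]C2≡nC2+n (suc p) ⟨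
    (2 + p) C 2                      ∎
    where
    open ≡-Reasoning
    T[1+p]+1 : turan p (suc p) + 1 ≡ p C 2 + p
    T[1+p]+1 = begin
      turan p (suc p) + 1      ≡⟨ cong (turan p (suc p) +_) (n/n≡1 p) ⟨
      turan p (suc p) + p / p  ≡⟨ turan-suc p ⟩
      turan p p + p            ≡⟨ cong (_+ p) (turan-complete ≤-refl) ⟩
      p C 2 + p                ∎
    T[2+p]+1 : turan p (2 + p) + 1 ≡ turan p (suc p) + suc p
    T[2+p]+1 = begin
      turan p (2 + p) + 1          ≡⟨ cong (turan p (2 + p) +_) (cong suc (m<n⇒m/n≡0 (s≤s 1≤k))) ⟨
      turan p (2 + p) + suc (1 / p) ≡⟨ cong (turan p (2 + p) +_) ([n+p]/p≡1+n/p 1) ⟨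
      turan p (2 + p) + suc p / p  ≡⟨ turan-suc (suc p) ⟩
      turan p (suc p) + suc p      ∎

  -- By the density bound it suffices to compare at n = p + 2.
  turan-sparse : 2 ≤ k → ∀ {n} → 2 + p ≤ n → (suc p C 2) * turan p n < (suc p C 2 ∸ 1) * (n C 2)
  turan-sparse 2≤k {n} 2+p≤n = subst (λ x → R * turan p n < x * N) (sym (cong (_∸ 1) R≡1+R′))
    (*-cancelˡ-< (T′ + 2) _ _ (begin-strict
      (T′ + 2) * (R * turan p n)  ≡⟨ x*[y*z]≡y*[x*z] (T′ + 2) R (turan p n) ⟩
      R * ((T′ + 2) * turan p n)  ≡⟨ cong (λ x → R * (x * turan p n)) (turan[2+p]+2≡[2+p]C2 1≤k) ⟩
      R * (((2 + p) C 2) * turan p n) ≤⟨ *-monoʳ-≤ R (turan-density-antitone 2+p≤n) ⟩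
      R * (T′ * N)                ≡⟨ *-assoc R T′ N ⟨
      R * T′ * N                  <⟨ *-monoˡ-< N {{>-nonZero N>0}} R*T′<[T′+2]*R′ ⟩
      (T′ + 2) * R′ * N           ≡⟨ *-assoc (T′ + 2) R′ N ⟩
      (T′ + 2) * (R′ * N)         ∎))
    where
    open ≤-Reasoning
    1≤k : 1 ≤ k
    1≤k = ≤-trans (s≤s z≤n) 2≤k
    R = suc p C 2
    R′ = p C 2 + k
    T′ = turan p (2 + p)
    N = n C 2
    N>0 : 0 < N
    N>0 = 2≤n⇒nC2>0 (≤-trans (s≤s (s≤s z≤n)) 2+p≤n)
    R≡1+R′ : R ≡ suc R′
    R≡1+R′ = trans ([1+n]C2≡nC2+n p) (+-suc (p C 2) k)
    p<R′ : p < R′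
    p<R′ = +-monoˡ-≤ k (≤-trans 2≤k (≤-trans (m≤n+m k (k C 2)) (≤-reflexive (sym ([1+n]C2≡nC2+n k)))))
    R*T′<[T′+2]*R′ : R * T′ < (T′ + 2) * R′
    R*T′<[T′+2]*R′ = subst (λ x → x * T′ < (T′ + 2) * R′) (sym R≡1+R′) ([1+r]*t<[t+2]*r p<R′ (begin-equality
      T′ + 2             ≡⟨ turan[2+p]+2≡[2+p]C2 1≤k ⟩
      (2 + p) C 2        ≡⟨ [1+n]C2≡nC2+n (suc p) ⟩
      R + suc p          ≡⟨ cong (_+ suc p) R≡1+R′ ⟩
      suc R′ + suc p     ∎))

ceilDiv-lowerBound : ∀ {a b c} → 0 < b → c * b < a → suc c ≤ ceilDiv a b
ceilDiv-lowerBound {a} {suc b} {c} _ c*b<a = begin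
  suc c                   ≡⟨ m*n/n≡m (suc c) (suc b) ⟨
  suc c * suc b / suc b   ≤⟨ /-monoˡ-≤ (suc b) (begin
    suc c * suc b           ≡⟨ +-suc b (c * suc b) ⟨
    b + suc (c * suc b)     ≤⟨ +-monoʳ-≤ b c*b<a ⟩
    b + a                   ≡⟨ +-comm b a ⟩
    a + b                   ∎) ⟩
  (a + b) / suc b         ∎
  where open ≤-Reasoning

-- With s = 1 + t: s (s - 1) ≤ 2 k t because s ≤ k + 1 ≤ 2 k, and 2 m ≤ k m.
[1+t]*t+2*m≤k*[[1+t]*m] : ∀ {k t m} → 2 ≤ k → t ≤ k → 2 ≤ m → suc t * t + 2 * m ≤ k * (suc t * m)
[1+t]*t+2*m≤k*[[1+t]*m] {k} {t} {m} 2≤k t≤k 2≤m = begin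
  suc t * t + 2 * m      ≤⟨ +-mono-≤ (*-monoˡ-≤ t 1+t≤2k) (*-monoˡ-≤ m 2≤k) ⟩
  2 * k * t + k * m      ≡⟨ cong (_+ k * m) (x*y*z≡y*[x*z] 2 k t) ⟩
  k * (2 * t) + k * m    ≤⟨ +-monoˡ-≤ (k * m) (*-monoʳ-≤ k (*-monoˡ-≤ t 2≤m)) ⟩
  k * (m * t) + k * m    ≡⟨ factor k t m ⟩
  k * (suc t * m)        ∎
  where
  open ≤-Reasoning
  1+t≤2k : suc t ≤ 2 * k
  1+t≤2k = begin
    suc t    ≤⟨ s≤s t≤k ⟩
    1 + k    ≡⟨ +-comm 1 k ⟩
    k + 1    ≤⟨ +-monoʳ-≤ k (≤-trans (s≤s z≤n) 2≤k) ⟩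
    k + k    ≡⟨ cong (k +_) (+-identityʳ k) ⟨
    2 * k    ∎
  factor : ∀ k t m → k * (m * t) + k * m ≡ k * (suc t * m)
  factor = solve-∀

p*[sC2+m]≤pC2*[s*m] : ∀ {k s m} → 2 ≤ k → 1 ≤ s → s ≤ suc k → 2 ≤ m →
                      suc k * (s C 2 + m) ≤ (suc k C 2) * (s * m)
p*[sC2+m]≤pC2*[s*m] {k} {suc t} {m} 2≤k _ s≤p 2≤m = *-cancelˡ-≤ 2 (begin
  2 * (p * (s C 2 + m))       ≡⟨ x*[y*z]≡y*[x*z] 2 p (s C 2 + m) ⟩
  p * (2 * (s C 2 + m))       ≡⟨ cong (p *_) (*-distribˡ-+ 2 (s C 2) m) ⟩
  p * (2 * (s C 2) + 2 * m)   ≡⟨ cong (λ x → p * (x + 2 * m)) (2*nC2≡n*pred[n] s) ⟩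
  p * (s * t + 2 * m)         ≤⟨ *-monoʳ-≤ p ([1+t]*t+2*m≤k*[[1+t]*m] 2≤k (≤-pred s≤p) 2≤m) ⟩
  p * (k * (s * m))           ≡⟨ *-assoc p k (s * m) ⟨
  p * k * (s * m)             ≡⟨ cong (_* (s * m)) (2*nC2≡n*pred[n] p) ⟨
  2 * (p C 2) * (s * m)       ≡⟨ *-assoc 2 (p C 2) (s * m) ⟩
  2 * ((p C 2) * (s * m))     ∎)
  where
  open ≤-Reasoning
  p = suc k
  s = suc t

binomial-gap : ∀ {k s m} → 2 ≤ k → 1 ≤ s → s ≤ suc k → 2 ≤ m →
  (suc (suc k) C 2) * (suc k * (s C 2) + k * (s * m)) + suc k * m
    ≤ suc k * ((suc (suc k) C 2 ∸ 1) * (s * m + s C 2))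
binomial-gap {k} {s} {m} 2≤k 1≤s s≤p 2≤m =
  subst (λ R → R * (p * (s C 2) + k * (s * m)) + p * m ≤ p * ((R ∸ 1) * (s * m + s C 2))) (sym [1+p]C2≡1+c+k)
    (+-cancelʳ-≤ (p * (s C 2 + m)) _ _ (begin
      suc (c + k) * (p * (s C 2) + k * (s * m)) + p * m + p * (s C 2 + m)
        ≤⟨ +-monoʳ-≤ _ (p*[sC2+m]≤pC2*[s*m] 2≤k 1≤s s≤p 2≤m) ⟩
      suc (c + k) * (p * (s C 2) + k * (s * m)) + p * m + c * (s * m)
        ≡⟨ rebalance c k (s C 2) (s * m) m ⟩
      p * ((c + k) * (s * m + s C 2)) + p * (s C 2 + m) ∎))
  where
  open ≤-Reasoning
  p = suc k
  c = p C 2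
  [1+p]C2≡1+c+k : suc p C 2 ≡ suc (c + k)
  [1+p]C2≡1+c+k = trans ([1+n]C2≡nC2+n p) (+-suc c k)
  rebalance : ∀ c k C x m → suc (c + k) * (suc k * C + k * x) + suc k * m + c * x
                        ≡ suc k * ((c + k) * (x + C)) + suc k * (C + m)
  rebalance = solve-∀

nC2∸[n∸s]C2 : ∀ {n s} → s ≤ n → n C 2 ∸ (n ∸ s) C 2 ≡ s * (n ∸ s) + s C 2
nC2∸[n∸s]C2 {n} {s} s≤n = begin
  n C 2 ∸ m C 2                    ≡⟨ cong (λ x → x C 2 ∸ m C 2) (m∸n+n≡m s≤n) ⟨
  (m + s) C 2 ∸ m C 2              ≡⟨ cong (_∸ m C 2) ([m+n]C2≡mC2+n*m+nC2 m s) ⟩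
  m C 2 + (s * m + s C 2) ∸ m C 2  ≡⟨ m+n∸m≡n (m C 2) _ ⟩
  s * m + s C 2                    ∎
  where
  open ≡-Reasoning
  m = n ∸ s

proposition3p1 : (n r : ℕ) → 3 ≤ r ∸ 1 → r ∸ 1 ≤ n →
    ((r + 1 ≤ n → (r C 2) + 1 ≤ ceilDiv (((r C 2) ∸ 1) * (n C 2)) (turan (r ∸ 1) n))
    × ((s : ℕ) → 1 ≤ s → s ≤ r ∸ 1 → s ≤ n ∸ 1 →
         (r ∸ 1) * turan (r ∸ 1) (n ∸ s) + ((r ∸ 1) * (s C 2) + (r ∸ 2) * (s * (n ∸ s)))
           ≤ (r ∸ 1) * turan (r ∸ 1) n)
    × ((s : ℕ) → 1 ≤ s → s ≤ n ∸ 1 →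
         ((n ∸ s) C 2) * turan (r ∸ 1) n ≤ turan (r ∸ 1) (n ∸ s) * (n C 2))
    × (r + 1 ≤ n → (s : ℕ) → 1 ≤ s → s ≤ r ∸ 1 →
         (r C 2) * ((r ∸ 1) * (s C 2) + (r ∸ 2) * (s * (n ∸ s))) + (r ∸ 1) * (n ∸ s)
           ≤ (r ∸ 1) * (((r C 2) ∸ 1) * ((n C 2) ∸ ((n ∸ s) C 2)))))
proposition3p1 n zero          ()  _
proposition3p1 n (suc zero)    ()  _
proposition3p1 n (suc (suc k)) 3≤p p≤n =
    (λ r+1≤n → subst (_≤ ceilDiv ((suc p C 2 ∸ 1) * (n C 2)) (turan p n)) (+-comm 1 (suc p C 2))
      (ceilDiv-lowerBound (turan-positive k 1≤k (≤-trans (s≤s (s≤s z≤n)) (2+p≤n r+1≤n)))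
                          (turan-sparse k 2≤k (2+p≤n r+1≤n))))
  , (λ s _ s≤p _ → subst (λ x → p * turan p (n ∸ s) + (p * (s C 2) + k * (s * (n ∸ s))) ≤ p * turan p x)
                         (m∸n+n≡m (≤-trans s≤p p≤n)) (turan-gap k (n ∸ s) s≤p))
  , (λ s _ _ → turan-density-antitone k (m∸n≤m n s))
  , (λ r+1≤n s 1≤s s≤p →
       subst (λ x → (suc p C 2) * (p * (s C 2) + k * (s * (n ∸ s))) + p * (n ∸ s) ≤ p * ((suc p C 2 ∸ 1) * x))
             (sym (nC2∸[n∸s]C2 (≤-trans s≤p p≤n)))
             (binomial-gap 2≤k 1≤s s≤p (m+n≤o⇒m≤o∸n 2 (≤-trans (+-monoʳ-≤ 2 s≤p) (2+p≤n r+1≤n)))))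
  where
  p = suc k
  2≤k : 2 ≤ k
  2≤k = ≤-pred 3≤p
  1≤k : 1 ≤ k
  1≤k = ≤-trans (s≤s z≤n) 2≤k
  2+p≤n : suc p + 1 ≤ n → 2 + p ≤ n
  2+p≤n = subst (_≤ n) (cong (2 +_) (+-comm k 1))
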